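{- Let $m$ and $n$ be natural numbers greater than $2$. Then $n$ is prime if and only if \[ \prod_{d=1}^{n-1}(1-m^d) \equiv n \pmod{\frac{m^n-1}{m-1}}. \] -}

module Defs where

open import Data.Nat as ℕ using (ℕ; zero; suc; _∸_; _^_; NonZero)
open import Data.Nat.DivMod using (_/_)
open import Data.Integer as ℤ using (ℤ; +_; _-_; _*_)
open import Data.Product using (∃)
open import Relation.Binary.PropositionalEquality using (_≡_)

prod₁ : ℕ → (ℕ → ℤ) → ℤ
prod₁ zero    f = + 1
prod₁ (suc k) f = prod₁ k f * f (suc k)

P : ℕ → ℕ → ℤ
P m n = prod₁ (n ∸ 1) (λ d → + 1 - + (m ^ d))

-- the modulus (m^n - 1)/(m - 1), natural-number division (exact when m ≥ 2);
-- for m ∈ {0,1} the quotient is undefined and we set it to 0 (never used: m > 2)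
M : (m n : ℕ) → ℕ
M (suc (suc k)) n = (suc (suc k) ^ n ∸ 1) / suc k
M _ _ = 0

_≡_[mod_] : ℤ → ℤ → ℤ → Set
a ≡ b [mod k ] = ∃ λ (q : ℤ) → a - b ≡ q * k

{-# OPTIONS --safe #-}
-- Write N = (m^n - 1)/(m - 1) = 1 + m + ⋯ + m^(n-1).
--
-- If n = a b with 2 ≤ a ≤ b, then (m^b - 1)/(m - 1) divides N and the factor 1 - m^b of
-- the product, so the congruence would make it divide n; but it exceeds b² ≥ n, except
-- for m = 3, n = 4, which is checked directly.
--
-- If n = p is prime, work in ℤ[C_p] = ℤ[g]/(g^p - 1), which maps to ℤ/N by g ↦ m, sending the
-- norm element Σ_j g^j to N ≡ 0. The polynomial H(y) = ∏_{d<p} (y - g^d) satisfies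
-- H(g y) = H(y), so for 0 < k < p its coefficient H_k is fixed by g^k, hence by g, i.e. it is
-- a multiple of the norm. Dividing H by y - 1 shows that every coefficient of
-- G(y) = ∏_{d=1}^{p-1} (y - g^d) is 1 plus a multiple of the norm, so
-- ∏_{d=1}^{p-1} (1 - g^d) = G(1) ≡ p, and g ↦ m gives the congruence.

module Submission where

open import Defs

open import Data.Empty using (⊥; ⊥-elim)
open import Data.Integer using (ℤ; +_; 0ℤ; 1ℤ; -_; _+_; _-_; _*_)
import Data.Integer.Properties as ℤP
open import Data.Integer.Divisibility.Signed
  using (_∣_; _∣?_; divides; ∣ᵤ⇒∣; ∣⇒∣ᵤ; ∣m⇒∣-m; ∣m∣n⇒∣m+n; ∣m∣n⇒∣m-n; ∣n⇒∣m*n; ∣m⇒∣m*n; ∣-trans)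
open import Data.Integer.Tactic.RingSolver using (solve-∀)
open import Data.List using (List; []; _∷_; _∷ʳ_; foldr; map; length; downFrom)
open import Data.List.Properties using (length-map; length-downFrom; downFrom-∷ʳ; map-downFrom)
open import Data.Nat as ℕ using (ℕ; zero; suc; _≤_; _<_; s≤s; _^_; _∸_)
open import Data.Nat.Coprimality using (Coprime; coprime-Bézout; prime⇒coprime)
open import Data.Nat.DivMod using (_%_; _/_; [m+n]%n≡m%n; m<n⇒m%n≡m; n%n≡0; m*n/n≡m)
open import Data.Nat.Divisibility as ℕ∣ using ()
open import Data.Nat.GCD using (module Bézout)
open import Data.Nat.Primality using (Prime; Composite; composite; composite⇒nonZero; ¬composite⇒prime)
import Data.Nat.Properties as ℕP
import Data.Nat.Tactic.RingSolver as ℕSolver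
open import Algebra.Properties.CommutativeSemigroup ℕP.+-commutativeSemigroup using (xy∙z≈xz∙y)
open import Data.Product using (∃; _,_; _×_)
open import Data.Sum using (inj₁; inj₂)
open import Function using (_∘_)
open import Function.Bundles using (_⇔_; mk⇔)
open import Level using (0ℓ)
open import Relation.Binary.Bundles using (Setoid)
open import Relation.Binary.PropositionalEquality
  using (_≡_; refl; sym; trans; cong; cong₂; subst; subst₂; _≗_; module ≡-Reasoning)
import Relation.Binary.Reasoning.Setoid
open import Relation.Nullary using (¬_)
open import Relation.Nullary.Decidable using (from-no)

module Congruence (k : ℤ) where

  -- _≡_[mod k ] as a record, so that a and b can be inferred from a proof
  infix 4 _≈_
  record _≈_ (a b : ℤ) : Set where
    constructor congruent
    field
      quotient : ℤ
      equation : a - b ≡ quotient * k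

  ≈⇒mod : ∀ {a b} → a ≈ b → a ≡ b [mod k ]
  ≈⇒mod (congruent q eq) = q , eq

  mod⇒≈ : ∀ {a b} → a ≡ b [mod k ] → a ≈ b
  mod⇒≈ (q , eq) = congruent q eq

  ≈⇒∣ : ∀ {a b} → a ≈ b → k ∣ a - b
  ≈⇒∣ (congruent q eq) = divides q eq

  ∣⇒≈ : ∀ {a b} → k ∣ a - b → a ≈ b
  ∣⇒≈ (divides q eq) = congruent q eq

  ≈-reflexive : ∀ {a b} → a ≡ b → a ≈ b
  ≈-reflexive {a} refl = congruent 0ℤ (trans (ℤP.+-inverseʳ a) (sym (ℤP.*-zeroˡ k)))

  ≈-sym : ∀ {a b} → a ≈ b → b ≈ a
  ≈-sym {a} {b} a≈b = ∣⇒≈ (subst (k ∣_) (-[a-b]≡b-a a b) (∣m⇒∣-m (≈⇒∣ a≈b)))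
    where
    -[a-b]≡b-a : ∀ a b → - (a - b) ≡ b - a
    -[a-b]≡b-a = solve-∀

  ≈-trans : ∀ {a b c} → a ≈ b → b ≈ c → a ≈ c
  ≈-trans {a} {b} {c} a≈b b≈c =
    ∣⇒≈ (subst (k ∣_) (telescope a b c) (∣m∣n⇒∣m+n (≈⇒∣ a≈b) (≈⇒∣ b≈c)))
    where
    telescope : ∀ a b c → (a - b) + (b - c) ≡ a - c
    telescope = solve-∀

  +-congˡ : ∀ c {a b} → a ≈ b → c + a ≈ c + b
  +-congˡ c {a} {b} a≈b = ∣⇒≈ (subst (k ∣_) (cancel c a b) (≈⇒∣ a≈b))
    where
    cancel : ∀ c a b → a - b ≡ (c + a) - (c + b)
    cancel = solve-∀

  *-congˡ : ∀ c {a b} → a ≈ b → c * a ≈ c * b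
  *-congˡ c {a} {b} a≈b = ∣⇒≈ (subst (k ∣_) (distrib c a b) (∣n⇒∣m*n c (≈⇒∣ a≈b)))
    where
    distrib : ∀ c a b → c * (a - b) ≡ c * a - c * b
    distrib = solve-∀

  -‿cong : ∀ {a b} → a ≈ b → - a ≈ - b
  -‿cong {a} {b} a≈b = ∣⇒≈ (subst (k ∣_) (distrib a b) (∣m⇒∣-m (≈⇒∣ a≈b)))
    where
    distrib : ∀ a b → - (a - b) ≡ - a - - b
    distrib = solve-∀

  multiple≈0 : ∀ q → q * k ≈ 0ℤ
  multiple≈0 q = congruent q (ℤP.+-identityʳ (q * k))

  setoid : Setoid 0ℓ 0ℓ
  setoid = record
    { Carrier       = ℤ
    ; _≈_           = _≈_
    ; isEquivalence = record { refl = ≈-reflexive refl ; sym = ≈-sym ; trans = ≈-trans }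
    }

  module ≈-Reasoning = Relation.Binary.Reasoning.Setoid setoid

repunit : ℕ → ℕ → ℕ
repunit m zero    = 0
repunit m (suc r) = suc (m ℕ.* repunit m r)

+[1+m*n]≡1+m*n : ∀ m n → + suc (m ℕ.* n) ≡ 1ℤ + + m * + n
+[1+m*n]≡1+m*n m n = trans (ℤP.pos-+ 1 (m ℕ.* n)) (cong (λ x → 1ℤ + x) (ℤP.pos-* m n))

[1+m]^r≡1+m*repunit : ∀ m r → suc m ^ r ≡ suc (m ℕ.* repunit (suc m) r)
[1+m]^r≡1+m*repunit m zero    = cong suc (sym (ℕP.*-zeroʳ m))
[1+m]^r≡1+m*repunit m (suc r) rewrite [1+m]^r≡1+m*repunit m r = expand m (repunit (suc m) r)
  where
  expand : ∀ m x → suc m ℕ.* suc (m ℕ.* x) ≡ suc (m ℕ.* suc (suc m ℕ.* x))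
  expand = ℕSolver.solve-∀

M≡repunit : ∀ k n → M (2 ℕ.+ k) n ≡ repunit (2 ℕ.+ k) n
M≡repunit k n rewrite [1+m]^r≡1+m*repunit (suc k) n =
  trans (cong (_/ suc k) (ℕP.*-comm (suc k) (repunit (2 ℕ.+ k) n))) (m*n/n≡m _ (suc k))

^≡1-mod-repunit : ∀ m r → (+ (m ^ r)) ≡ 1ℤ [mod + repunit m r ]
^≡1-mod-repunit m r = + m - 1ℤ , m^r-1≡[m-1]*repunit r
  where
  open ≡-Reasoning
  m^r-1≡[m-1]*repunit : ∀ r → + (m ^ r) - 1ℤ ≡ (+ m - 1ℤ) * + repunit m r
  m^r-1≡[m-1]*repunit zero    = sym (ℤP.*-zeroʳ (+ m - 1ℤ))
  m^r-1≡[m-1]*repunit (suc r) = begin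
      + (m ℕ.* m ^ r) - 1ℤ
    ≡⟨ cong (_- 1ℤ) (ℤP.pos-* m (m ^ r)) ⟩
      + m * + (m ^ r) - 1ℤ
    ≡⟨ split (+ m) (+ (m ^ r)) ⟩
      + m * (+ (m ^ r) - 1ℤ) + (+ m - 1ℤ)
    ≡⟨ cong (λ e → + m * e + (+ m - 1ℤ)) (m^r-1≡[m-1]*repunit r) ⟩
      + m * ((+ m - 1ℤ) * + repunit m r) + (+ m - 1ℤ)
    ≡⟨ factor (+ m) (+ repunit m r) ⟩
      (+ m - 1ℤ) * (1ℤ + + m * + repunit m r)
    ≡⟨ cong ((+ m - 1ℤ) *_) (sym (+[1+m*n]≡1+m*n m (repunit m r))) ⟩
      (+ m - 1ℤ) * + repunit m (suc r)
    ∎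
    where
    split : ∀ x a → x * a - 1ℤ ≡ x * (a - 1ℤ) + (x - 1ℤ)
    split = solve-∀
    factor : ∀ x R → x * ((x - 1ℤ) * R) + (x - 1ℤ) ≡ (x - 1ℤ) * (1ℤ + x * R)
    factor = solve-∀

repunit-+ : ∀ m a b → repunit m (a ℕ.+ b) ≡ repunit m a ℕ.+ m ^ a ℕ.* repunit m b
repunit-+ m zero    b = sym (ℕP.+-identityʳ (repunit m b))
repunit-+ m (suc a) b rewrite repunit-+ m a b = expand m (repunit m a) (m ^ a) (repunit m b)
  where
  expand : ∀ m x y z → suc (m ℕ.* (x ℕ.+ y ℕ.* z)) ≡ suc (m ℕ.* x) ℕ.+ m ℕ.* y ℕ.* z
  expand = ℕSolver.solve-∀

repunit∣repunit-* : ∀ m a b → repunit m b ℕ∣.∣ repunit m (a ℕ.* b)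
repunit∣repunit-* m zero    b = repunit m b ℕ∣.∣0
repunit∣repunit-* m (suc a) b rewrite repunit-+ m b (a ℕ.* b) =
  ℕ∣.∣m∣n⇒∣m+n ℕ∣.∣-refl (ℕ∣.∣n⇒∣m*n (m ^ b) (repunit∣repunit-* m a b))

square<repunit : ∀ {m} → 3 ≤ m → ∀ c → (3 ℕ.+ c) ℕ.* (3 ℕ.+ c) ℕ.< repunit m (3 ℕ.+ c)
square<repunit 3≤m zero    =
  s≤s (ℕP.≤-trans (ℕP.m≤n+m 9 3) (ℕP.*-mono-≤ 3≤m (s≤s (ℕP.*-mono-≤ 3≤m (s≤s ℕ.z≤n)))))
square<repunit 3≤m (suc c) =
  s≤s (ℕP.≤-trans (square-step (2 ℕ.+ c)) (ℕP.*-mono-≤ 3≤m (square<repunit 3≤m c)))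
  where
  square-step : ∀ z → suc (suc z) ℕ.* suc (suc z) ℕ.≤ 3 ℕ.* suc (suc z ℕ.* suc z)
  square-step z = subst (suc (suc z) ℕ.* suc (suc z) ℕ.≤_) (expand z) (ℕP.m≤m+n _ _)
    where
    expand : ∀ z → suc (suc z) ℕ.* suc (suc z) ℕ.+ (2 ℕ.* z ℕ.* z ℕ.+ 2 ℕ.* z ℕ.+ 2)
                   ≡ 3 ℕ.* suc (suc z ℕ.* suc z)
    expand = ℕSolver.solve-∀

Periodic : {A : Set} → ℕ → (ℕ → A) → Set
Periodic a f = ∀ j → f (j ℕ.+ a) ≡ f j

module _ {A : Set} {f : ℕ → A} where

  periodic-shift : ∀ {a} → Periodic a f → ∀ d → Periodic a (λ j → f (j ℕ.+ d))
  periodic-shift {a} f-per d j = trans (cong f (xy∙z≈xz∙y j a d)) (f-per (j ℕ.+ d))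

  periodic-* : ∀ {a} → Periodic a f → ∀ t → Periodic (t ℕ.* a) f
  periodic-* f-per zero    j = cong f (ℕP.+-identityʳ j)
  periodic-* {a} f-per (suc t) j = begin
      f (j ℕ.+ (a ℕ.+ t ℕ.* a))  ≡⟨ cong f (ℕP.+-assoc j a (t ℕ.* a)) ⟨
      f (j ℕ.+ a ℕ.+ t ℕ.* a)    ≡⟨ periodic-* f-per t (j ℕ.+ a) ⟩
      f (j ℕ.+ a)                ≡⟨ f-per j ⟩
      f j                        ∎
    where open ≡-Reasoning

  bézout⇒step : ∀ {a b} → Periodic a f → Periodic b f → ∀ x y → 1 ℕ.+ y ℕ.* b ≡ x ℕ.* a →
                ∀ j → f (suc j) ≡ f j
  bézout⇒step {a} {b} f-per-a f-per-b x y eq j = begin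
      f (suc j)                   ≡⟨ periodic-* f-per-b y (suc j) ⟨
      f (suc j ℕ.+ y ℕ.* b)       ≡⟨ cong f (trans (sym (ℕP.+-suc j (y ℕ.* b))) (cong (j ℕ.+_) eq)) ⟩
      f (j ℕ.+ x ℕ.* a)           ≡⟨ periodic-* f-per-a x j ⟩
      f j                         ∎
    where open ≡-Reasoning

  coprime-periods⇒constant : ∀ {a b} → Coprime a b → Periodic a f → Periodic b f → ∀ j → f j ≡ f 0
  coprime-periods⇒constant {a} {b} coprime f-per-a f-per-b = constant
    where
    step : ∀ j → f (suc j) ≡ f j
    step with coprime-Bézout coprime
    ... | Bézout.+- x y eq = bézout⇒step f-per-a f-per-b x y eq
    ... | Bézout.-+ x y eq = bézout⇒step f-per-b f-per-a y x eq
    constant : ∀ j → f j ≡ f 0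
    constant zero    = refl
    constant (suc j) = trans (step j) (constant j)

-- Evaluation of ℤ[C_p] at g = m

module Evaluation (m : ℕ) where

  ev : ℕ → (ℕ → ℤ) → ℤ
  ev zero    f = 0ℤ
  ev (suc r) f = + m * ev r f + f r

  ev-cong : ∀ r {f g} → f ≗ g → ev r f ≡ ev r g
  ev-cong zero    f≗g = refl
  ev-cong (suc r) f≗g = cong₂ (λ x y → + m * x + y) (ev-cong r f≗g) (f≗g r)

  ev-+ : ∀ r (f g : ℕ → ℤ) → ev r (λ j → f j + g j) ≡ ev r f + ev r g
  ev-+ zero    f g = refl
  ev-+ (suc r) f g rewrite ev-+ r f g = regroup (+ m) (ev r f) (ev r g) (f r) (g r)
    where
    regroup : ∀ x a b c d → x * (a + b) + (c + d) ≡ (x * a + c) + (x * b + d)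
    regroup = solve-∀

  ev-neg : ∀ r (f : ℕ → ℤ) → ev r (λ j → - f j) ≡ - ev r f
  ev-neg zero    f = refl
  ev-neg (suc r) f rewrite ev-neg r f = regroup (+ m) (ev r f) (f r)
    where
    regroup : ∀ x a c → x * (- a) + (- c) ≡ - (x * a + c)
    regroup = solve-∀

  ev-*ˡ : ∀ r c (f : ℕ → ℤ) → ev r (λ j → c * f j) ≡ c * ev r f
  ev-*ˡ zero    c f = sym (ℤP.*-zeroʳ c)
  ev-*ˡ (suc r) c f rewrite ev-*ˡ r c f = regroup (+ m) c (ev r f) (f r)
    where
    regroup : ∀ x c a b → x * (c * a) + c * b ≡ c * (x * a + b)
    regroup = solve-∀

  ev-const : ∀ r c → ev r (λ _ → c) ≡ c * + repunit m r
  ev-const zero    c = sym (ℤP.*-zeroʳ c)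
  ev-const (suc r) c = begin
      + m * ev r (λ _ → c) + c          ≡⟨ cong (λ e → + m * e + c) (ev-const r c) ⟩
      + m * (c * + repunit m r) + c     ≡⟨ regroup (+ m) c (+ repunit m r) ⟩
      c * (1ℤ + + m * + repunit m r)    ≡⟨ cong (c *_) (+[1+m*n]≡1+m*n m (repunit m r)) ⟨
      c * + repunit m (suc r)           ∎
    where
    open ≡-Reasoning
    regroup : ∀ x c R → x * (c * R) + c ≡ c * (1ℤ + x * R)
    regroup = solve-∀

  ev-suc : ∀ r f → ev (suc r) f ≡ f 0 * + (m ^ r) + ev r (f ∘ suc)
  ev-suc zero    f = regroup (+ m) (f 0)
    where
    regroup : ∀ x a → x * 0ℤ + a ≡ a * 1ℤ + 0ℤ
    regroup = solve-∀
  ev-suc (suc r) f = begin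
      + m * ev (suc r) f + f (suc r)
    ≡⟨ cong (λ e → + m * e + f (suc r)) (ev-suc r f) ⟩
      + m * (f 0 * + (m ^ r) + ev r (f ∘ suc)) + f (suc r)
    ≡⟨ regroup (+ m) (f 0) (+ (m ^ r)) (ev r (f ∘ suc)) (f (suc r)) ⟩
      f 0 * (+ m * + (m ^ r)) + (+ m * ev r (f ∘ suc) + f (suc r))
    ≡⟨ cong (λ e → f 0 * e + ev (suc r) (f ∘ suc)) (ℤP.pos-* m (m ^ r)) ⟨
      f 0 * + (m ^ suc r) + ev (suc r) (f ∘ suc)
    ∎
    where
    open ≡-Reasoning
    regroup : ∀ x a y e b → x * (a * y + e) + b ≡ a * (x * y) + (x * e + b)
    regroup = solve-∀

  module _ (p : ℕ) where
    open Congruence (+ repunit m p)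

    ev-rotate : ∀ {f} → Periodic p f → ev p (f ∘ suc) ≈ + m * ev p f
    ev-rotate {f} f-per = begin
        ev p (f ∘ suc)
      ≡⟨ isolate (ev p (f ∘ suc)) (f 0) (+ (m ^ p)) ⟩
        (f 0 * + (m ^ p) + ev p (f ∘ suc)) + (- f 0) * + (m ^ p)
      ≡⟨ cong (_+ (- f 0) * + (m ^ p)) expand-both-ends ⟩
        (+ m * ev p f + f 0) + (- f 0) * + (m ^ p)
      ≈⟨ +-congˡ (+ m * ev p f + f 0) (*-congˡ (- f 0) (mod⇒≈ (^≡1-mod-repunit m p))) ⟩
        (+ m * ev p f + f 0) + (- f 0) * 1ℤ
      ≡⟨ cancel (+ m * ev p f) (f 0) ⟩
        + m * ev p f
      ∎
      where
      open ≈-Reasoning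
      expand-both-ends : f 0 * + (m ^ p) + ev p (f ∘ suc) ≡ + m * ev p f + f 0
      expand-both-ends = trans (sym (ev-suc p f)) (cong (λ e → + m * ev p f + e) (f-per 0))
      isolate : ∀ e c y → e ≡ (c * y + e) + (- c) * y
      isolate = solve-∀
      cancel : ∀ a c → (a + c) + (- c) * 1ℤ ≡ a
      cancel = solve-∀

    ev-shift : ∀ {f} → Periodic p f → ∀ d → ev p (λ j → f (j ℕ.+ d)) ≈ + (m ^ d) * ev p f
    ev-shift {f} f-per zero =
      ≈-reflexive (trans (ev-cong p (cong f ∘ ℕP.+-identityʳ)) (sym (ℤP.*-identityˡ (ev p f))))
    ev-shift {f} f-per (suc d) = begin
        ev p (λ j → f (j ℕ.+ suc d))
      ≡⟨ ev-cong p (cong f ∘ λ j → ℕP.+-suc j d) ⟩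
        ev p (λ j → f (suc j ℕ.+ d))
      ≈⟨ ev-rotate (periodic-shift f-per d) ⟩
        + m * ev p (λ j → f (j ℕ.+ d))
      ≈⟨ *-congˡ (+ m) (ev-shift f-per d) ⟩
        + m * (+ (m ^ d) * ev p f)
      ≡⟨ ℤP.*-assoc (+ m) (+ (m ^ d)) (ev p f) ⟨
        + m * + (m ^ d) * ev p f
      ≡⟨ cong (_* ev p f) (ℤP.pos-* m (m ^ d)) ⟨
        + (m ^ suc d) * ev p f
      ∎
      where open ≈-Reasoning

    ev-[1-g^d] : ∀ {f} → Periodic p f → ∀ d →
                 ev p (λ j → f j - f (j ℕ.+ d)) ≈ (1ℤ - + (m ^ d)) * ev p f
    ev-[1-g^d] {f} f-per d = begin
        ev p (λ j → f j - f (j ℕ.+ d))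
      ≡⟨ ev-+ p f (λ j → - f (j ℕ.+ d)) ⟩
        ev p f + ev p (λ j → - f (j ℕ.+ d))
      ≡⟨ cong (λ e → ev p f + e) (ev-neg p (λ j → f (j ℕ.+ d))) ⟩
        ev p f - ev p (λ j → f (j ℕ.+ d))
      ≈⟨ +-congˡ (ev p f) (-‿cong (ev-shift f-per d)) ⟩
        ev p f - + (m ^ d) * ev p f
      ≡⟨ factor (ev p f) (+ (m ^ d)) ⟩
        (1ℤ - + (m ^ d)) * ev p f
      ∎
      where
      open ≈-Reasoning
      factor : ∀ e x → e - x * e ≡ (1ℤ - x) * e
      factor = solve-∀

-- Polynomials over ℤ[C_p]

module GroupRingPolynomials (q : ℕ) where

  p : ℕ
  p = suc q

  -- A p-periodic f : ℕ → ℤ stands for Σ_{j<p} f j · g^(p-1-j) ∈ ℤ[C_p], so f ∘ (_+ d) is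
  -- g^d · f, the constant functions are the multiples of the norm element Σ_{j<p} g^j,
  -- and δ is the unit.
  isZero : ℕ → ℤ
  isZero zero    = 1ℤ
  isZero (suc _) = 0ℤ

  δ : ℕ → ℤ
  δ j = isZero (suc j % p)

  δ-periodic : Periodic p δ
  δ-periodic j = cong isZero ([m+n]%n≡m%n (suc j) p)

  infix 4 _≡_·δ+const
  record _≡_·δ+const (f : ℕ → ℤ) (a : ℤ) : Set where
    constructor _,_
    field
      constant : ℤ
      equation : ∀ j → f j ≡ a * δ j + constant

  ≡·δ+const-resp : ∀ {f g a} → f ≗ g → g ≡ a ·δ+const → f ≡ a ·δ+const
  ≡·δ+const-resp f≗g (c , g≡) = c , λ j → trans (f≗g j) (g≡ j)

  constant⇒≡0·δ+const : ∀ {f} → (∀ j → f j ≡ f 0) → f ≡ 0ℤ ·δ+const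
  constant⇒≡0·δ+const {f} f-const = f 0 , λ j → trans (f-const j) (sym (ℤP.+-identityˡ (f 0)))

  ≡·δ+const-+ : ∀ {f g a b} → f ≡ a ·δ+const → g ≡ b ·δ+const →
                (λ j → f j + g j) ≡ (a + b) ·δ+const
  ≡·δ+const-+ {a = a} {b} (c , f≡) (d , g≡) = c + d , λ j →
    trans (cong₂ _+_ (f≡ j) (g≡ j)) (regroup a b (δ j) c d)
    where
    regroup : ∀ a b x c d → (a * x + c) + (b * x + d) ≡ (a + b) * x + (c + d)
    regroup = solve-∀

  -- F k is the coefficient of y^k.
  Poly : Set
  Poly = ℕ → ℕ → ℤ

  infix 4 _≈ᴾ_
  _≈ᴾ_ : Poly → Poly → Set
  F ≈ᴾ G = ∀ k j → F k j ≡ G k j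

  ≈ᴾ-trans : ∀ {F G H} → F ≈ᴾ G → G ≈ᴾ H → F ≈ᴾ H
  ≈ᴾ-trans F≈G G≈H k j = trans (F≈G k j) (G≈H k j)

  PeriodicPoly : Poly → Set
  PeriodicPoly F = ∀ k → Periodic p (F k)

  one : Poly
  one zero    = δ
  one (suc k) = λ _ → 0ℤ

  -- F ↦ (y - g^d) F
  mulLin : ℕ → Poly → Poly
  mulLin d F zero    j = - F zero (j ℕ.+ d)
  mulLin d F (suc k) j = F k j - F (suc k) (j ℕ.+ d)

  linProd : List ℕ → Poly
  linProd = foldr mulLin one

  mulLin-periodic : ∀ d {F} → PeriodicPoly F → PeriodicPoly (mulLin d F)
  mulLin-periodic d F-per zero    j = cong -_ (periodic-shift (F-per 0) d j)
  mulLin-periodic d F-per (suc k) j = cong₂ _-_ (F-per k j) (periodic-shift (F-per (suc k)) d j)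

  linProd-periodic : ∀ L → PeriodicPoly (linProd L)
  linProd-periodic []      zero    = δ-periodic
  linProd-periodic []      (suc k) j = refl
  linProd-periodic (d ∷ L) = mulLin-periodic d (linProd-periodic L)

  mulLin-cong : ∀ d {F G} → F ≈ᴾ G → mulLin d F ≈ᴾ mulLin d G
  mulLin-cong d F≈G zero    j = cong -_ (F≈G 0 (j ℕ.+ d))
  mulLin-cong d F≈G (suc k) j = cong₂ _-_ (F≈G k j) (F≈G (suc k) (j ℕ.+ d))

  mulLin-comm : ∀ a b F → mulLin a (mulLin b F) ≈ᴾ mulLin b (mulLin a F)
  mulLin-comm a b F zero          j = cong (λ i → - (- F 0 i)) (xy∙z≈xz∙y j a b)
  mulLin-comm a b F (suc zero)    j rewrite xy∙z≈xz∙y j a b =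
    swap (F 0 (j ℕ.+ b)) (F 0 (j ℕ.+ a)) (F 1 (j ℕ.+ b ℕ.+ a))
    where
    swap : ∀ x y z → - x - (y - z) ≡ - y - (x - z)
    swap = solve-∀
  mulLin-comm a b F (suc (suc k)) j rewrite xy∙z≈xz∙y j a b =
    swap (F k j) (F (suc k) (j ℕ.+ b)) (F (suc k) (j ℕ.+ a)) (F (suc (suc k)) (j ℕ.+ b ℕ.+ a))
    where
    swap : ∀ x y z w → (x - y) - (z - w) ≡ (x - z) - (y - w)
    swap = solve-∀

  linProd-∷ʳ : ∀ L a → linProd (L ∷ʳ a) ≈ᴾ linProd (a ∷ L)
  linProd-∷ʳ []      a k j = refl
  linProd-∷ʳ (b ∷ L) a = ≈ᴾ-trans (mulLin-cong b (linProd-∷ʳ L a)) (mulLin-comm b a (linProd L))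

  mulLin-period : ∀ {F} → PeriodicPoly F → mulLin p F ≈ᴾ mulLin 0 F
  mulLin-period {F} F-per zero    j = cong -_ (trans (F-per 0 j) (cong (F 0) (sym (ℕP.+-identityʳ j))))
  mulLin-period {F} F-per (suc k) j =
    cong (λ e → F k j - e) (trans (F-per (suc k) j) (cong (F (suc k)) (sym (ℕP.+-identityʳ j))))

  -- F(g y) and g^n F(y)
  scale : Poly → Poly
  scale F k j = F k (j ℕ.+ k)

  shiftᴾ : ℕ → Poly → Poly
  shiftᴾ n F k j = F k (j ℕ.+ n)

  scale-mulLin-suc : ∀ d n {F G} → scale G ≈ᴾ shiftᴾ n F →
                     scale (mulLin (suc d) G) ≈ᴾ shiftᴾ (suc n) (mulLin d F)
  scale-mulLin-suc d n {F} {G} G≈F zero    j = cong -_ (begin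
      G 0 (j ℕ.+ 0 ℕ.+ suc d)     ≡⟨ cong (G 0) (shuffle₀ j d) ⟩
      G 0 (j ℕ.+ suc d ℕ.+ 0)     ≡⟨ G≈F 0 (j ℕ.+ suc d) ⟩
      F 0 (j ℕ.+ suc d ℕ.+ n)     ≡⟨ cong (F 0) (shuffle₁ j d n) ⟩
      F 0 (j ℕ.+ suc n ℕ.+ d)     ∎)
    where
    open ≡-Reasoning
    shuffle₀ : ∀ j d → j ℕ.+ 0 ℕ.+ suc d ≡ j ℕ.+ suc d ℕ.+ 0
    shuffle₀ = ℕSolver.solve-∀
    shuffle₁ : ∀ j d n → j ℕ.+ suc d ℕ.+ n ≡ j ℕ.+ suc n ℕ.+ d
    shuffle₁ = ℕSolver.solve-∀
  scale-mulLin-suc d n {F} {G} G≈F (suc k) j = cong₂ _-_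
    (begin
      G k (j ℕ.+ suc k)               ≡⟨ cong (G k) (ℕP.+-suc j k) ⟩
      G k (suc j ℕ.+ k)               ≡⟨ G≈F k (suc j) ⟩
      F k (suc j ℕ.+ n)               ≡⟨ cong (F k) (ℕP.+-suc j n) ⟨
      F k (j ℕ.+ suc n)               ∎)
    (begin
      G (suc k) (j ℕ.+ suc k ℕ.+ suc d)   ≡⟨ cong (G (suc k)) (shuffle₂ j k d) ⟩
      G (suc k) (suc j ℕ.+ d ℕ.+ suc k)   ≡⟨ G≈F (suc k) (suc j ℕ.+ d) ⟩
      F (suc k) (suc j ℕ.+ d ℕ.+ n)       ≡⟨ cong (F (suc k)) (shuffle₃ j d n) ⟩
      F (suc k) (j ℕ.+ suc n ℕ.+ d)       ∎)
    where
    open ≡-Reasoning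
    shuffle₂ : ∀ j k d → j ℕ.+ suc k ℕ.+ suc d ≡ suc j ℕ.+ d ℕ.+ suc k
    shuffle₂ = ℕSolver.solve-∀
    shuffle₃ : ∀ j d n → suc j ℕ.+ d ℕ.+ n ≡ j ℕ.+ suc n ℕ.+ d
    shuffle₃ = ℕSolver.solve-∀

  scale-linProd-suc : ∀ L → scale (linProd (map suc L)) ≈ᴾ shiftᴾ (length L) (linProd L)
  scale-linProd-suc []      zero    j = refl
  scale-linProd-suc []      (suc k) j = refl
  scale-linProd-suc (d ∷ L) = scale-mulLin-suc d (length L) (scale-linProd-suc L)

  linProd-vanishes : ∀ L {k} → length L ℕ.< k → ∀ j → linProd L k j ≡ 0ℤ
  linProd-vanishes []      {suc k} _           j = refl
  linProd-vanishes (d ∷ L) {suc k} (s≤s |L|<k) j =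
    cong₂ _-_ (linProd-vanishes L |L|<k j) (linProd-vanishes L (ℕP.m<n⇒m<1+n |L|<k) (j ℕ.+ d))

  linProd-leading : ∀ L j → linProd L (length L) j ≡ δ j
  linProd-leading []      j = refl
  linProd-leading (d ∷ L) j = begin
      linProd L (length L) j - linProd L (suc (length L)) (j ℕ.+ d)
    ≡⟨ cong₂ _-_ (linProd-leading L j) (linProd-vanishes L ℕP.≤-refl (j ℕ.+ d)) ⟩
      δ j - 0ℤ
    ≡⟨ ℤP.+-identityʳ (δ j) ⟩
      δ j
    ∎
    where open ≡-Reasoning

  -- F(1), once B > deg F
  coeffSum : ℕ → Poly → ℕ → ℤ
  coeffSum zero    F j = 0ℤ
  coeffSum (suc B) F j = F B j + coeffSum B F j

  coeffSum-periodic : ∀ B {F} → PeriodicPoly F → Periodic p (coeffSum B F)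
  coeffSum-periodic zero    F-per j = refl
  coeffSum-periodic (suc B) F-per j = cong₂ _+_ (F-per B j) (coeffSum-periodic B F-per j)

  coeffSum-mulLin : ∀ B d F → (∀ j → F B j ≡ 0ℤ) →
                    ∀ j → coeffSum (suc B) (mulLin d F) j ≡ coeffSum B F j - coeffSum B F (j ℕ.+ d)
  coeffSum-mulLin B d F F[B]≡0 j = trans (telescope B j)
    (cong (λ e → coeffSum B F j - e)
      (trans (cong (_+ coeffSum B F (j ℕ.+ d)) (F[B]≡0 (j ℕ.+ d))) (ℤP.+-identityˡ _)))
    where
    telescope : ∀ B j → coeffSum (suc B) (mulLin d F) j ≡ coeffSum B F j - coeffSum (suc B) F (j ℕ.+ d)
    telescope zero    j = regroup (F 0 (j ℕ.+ d))
      where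
      regroup : ∀ x → - x + 0ℤ ≡ 0ℤ - (x + 0ℤ)
      regroup = solve-∀
    telescope (suc B) j =
      trans (cong (λ e → mulLin d F (suc B) j + e) (telescope B j))
            (regroup (F B j) (F (suc B) (j ℕ.+ d)) (coeffSum B F j) (coeffSum (suc B) F (j ℕ.+ d)))
      where
      regroup : ∀ x y S T → (x - y) + (S - T) ≡ (x + S) - (y + T)
      regroup = solve-∀

-- The congruence for prime p

length-map-suc-downFrom : ∀ r → length (map suc (downFrom r)) ≡ r
length-map-suc-downFrom r = trans (length-map suc (downFrom r)) (length-downFrom r)

module CyclotomicCongruence (m q : ℕ) where

  open GroupRingPolynomials q
  open Evaluation m
  open Congruence (+ repunit m p)

  ev-δ : ev p δ ≡ 1ℤ
  ev-δ = begin
      + m * ev q δ + δ q   ≡⟨ cong₂ (λ x y → + m * x + y) (ev-below q ℕP.≤-refl) (cong isZero (n%n≡0 p)) ⟩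
      + m * 0ℤ + 1ℤ        ≡⟨ cong (_+ 1ℤ) (ℤP.*-zeroʳ (+ m)) ⟩
      1ℤ                   ∎
    where
    open ≡-Reasoning
    ev-below : ∀ r → r ≤ q → ev r δ ≡ 0ℤ
    ev-below zero    _   = refl
    ev-below (suc r) r<q = begin
      + m * ev r δ + δ r   ≡⟨ cong₂ (λ x y → + m * x + y) (ev-below r (ℕP.<⇒≤ r<q))
                                                         (cong isZero (m<n⇒m%n≡m (s≤s r<q))) ⟩
      + m * 0ℤ + 0ℤ        ≡⟨ cong (_+ 0ℤ) (ℤP.*-zeroʳ (+ m)) ⟩
      0ℤ                   ∎

  ev-≡·δ+const : ∀ {f a} → f ≡ a ·δ+const → ev p f ≈ a
  ev-≡·δ+const {f} {a} (c , f≡) = begin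
      ev p f                                    ≡⟨ ev-cong p f≡ ⟩
      ev p (λ j → a * δ j + c)                  ≡⟨ ev-+ p (λ j → a * δ j) (λ _ → c) ⟩
      ev p (λ j → a * δ j) + ev p (λ _ → c)     ≡⟨ cong₂ _+_ (ev-*ˡ p a δ) (ev-const p c) ⟩
      a * ev p δ + c * + repunit m p            ≈⟨ +-congˡ (a * ev p δ) (multiple≈0 c) ⟩
      a * ev p δ + 0ℤ                           ≡⟨ ℤP.+-identityʳ (a * ev p δ) ⟩
      a * ev p δ                                ≡⟨ cong (a *_) ev-δ ⟩
      a * 1ℤ                                    ≡⟨ ℤP.*-identityʳ a ⟩
      a                                         ∎
    where open ≈-Reasoning

  ev-coeffSum-linProd : ∀ r →
    ev p (coeffSum (suc r) (linProd (map suc (downFrom r)))) ≈ prod₁ r (λ d → 1ℤ - + (m ^ d))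
  ev-coeffSum-linProd zero    = ≈-reflexive (trans (ev-cong p (λ j → ℤP.+-identityʳ (δ j))) ev-δ)
  ev-coeffSum-linProd (suc r) = begin
      ev p (coeffSum (2 ℕ.+ r) (mulLin (suc r) F))
    ≡⟨ ev-cong p (coeffSum-mulLin (suc r) (suc r) F F[1+r]≡0) ⟩
      ev p (λ j → coeffSum (suc r) F j - coeffSum (suc r) F (j ℕ.+ suc r))
    ≈⟨ ev-[1-g^d] p (coeffSum-periodic (suc r) (linProd-periodic L)) (suc r) ⟩
      (1ℤ - + (m ^ suc r)) * ev p (coeffSum (suc r) F)
    ≈⟨ *-congˡ (1ℤ - + (m ^ suc r)) (ev-coeffSum-linProd r) ⟩
      (1ℤ - + (m ^ suc r)) * prod₁ r (λ d → 1ℤ - + (m ^ d))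
    ≡⟨ ℤP.*-comm (1ℤ - + (m ^ suc r)) _ ⟩
      prod₁ (suc r) (λ d → 1ℤ - + (m ^ d))
    ∎
    where
    open ≈-Reasoning
    L : List ℕ
    L = map suc (downFrom r)
    F : Poly
    F = linProd L
    F[1+r]≡0 : ∀ j → F (suc r) j ≡ 0ℤ
    F[1+r]≡0 = linProd-vanishes L (ℕP.≤-reflexive (cong suc (length-map-suc-downFrom r)))

  G : Poly
  G = linProd (map suc (downFrom q))

  H : Poly
  H = mulLin p G

  G-leading : ∀ j → G q j ≡ δ j
  G-leading j =
    subst (λ k → G k j ≡ δ j) (length-map-suc-downFrom q) (linProd-leading (map suc (downFrom q)) j)

  -- H = (y - g^p) G = (y - 1) G
  G-step : ∀ k j → G k j ≡ H (suc k) j + G (suc k) j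
  G-step k j = trans (regroup (G k j) (G (suc k) j))
    (cong (λ e → (G k j - e) + G (suc k) j) (sym (linProd-periodic (map suc (downFrom q)) (suc k) j)))
    where
    regroup : ∀ x y → x ≡ (x - y) + y
    regroup = solve-∀

  -- Multiplying y by g permutes the roots g^0, …, g^(p-1) of H.
  H-scale-invariant : scale H ≈ᴾ H
  H-scale-invariant = ≈ᴾ-trans (scale-linProd-suc (downFrom p)) λ k j → begin
      linProd (downFrom p) k (j ℕ.+ length (downFrom p))
    ≡⟨ cong (λ n → linProd (downFrom p) k (j ℕ.+ n)) (length-downFrom p) ⟩
      linProd (downFrom p) k (j ℕ.+ p)
    ≡⟨ linProd-periodic (downFrom p) k j ⟩
      linProd (downFrom p) k j
    ≡⟨ cong (λ L → linProd L k j) (trans (cong (_∷ʳ 0) (map-downFrom suc q)) (downFrom-∷ʳ q)) ⟨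
      linProd (map suc (downFrom q) ∷ʳ 0) k j
    ≡⟨ linProd-∷ʳ (map suc (downFrom q)) 0 k j ⟩
      mulLin 0 G k j
    ≡⟨ mulLin-period (linProd-periodic (map suc (downFrom q))) k j ⟨
      H k j
    ∎
    where open ≡-Reasoning

  module _ (prime : Prime p) where

    H-coeff-constant : ∀ k → k ℕ.< q → ∀ j → H (suc k) j ≡ H (suc k) 0
    H-coeff-constant k k<q = coprime-periods⇒constant (prime⇒coprime prime (s≤s k<q))
      (linProd-periodic (map suc (downFrom p)) (suc k)) (H-scale-invariant (suc k))

    G-coeff : ∀ k → k ≤ q → G k ≡ 1ℤ ·δ+const
    G-coeff k k≤q = from-top (q ∸ k) k (ℕP.m∸n+n≡m k≤q)
      where
      from-top : ∀ s k → s ℕ.+ k ≡ q → G k ≡ 1ℤ ·δ+const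
      from-top zero    k refl = 0ℤ , λ j →
        trans (G-leading j) (sym (trans (ℤP.+-identityʳ _) (ℤP.*-identityˡ (δ j))))
      from-top (suc s) k eq   = ≡·δ+const-resp (G-step k)
        (≡·δ+const-+ (constant⇒≡0·δ+const (H-coeff-constant k k<q))
                     (from-top s (suc k) (trans (ℕP.+-suc s k) eq)))
        where
        k<q : k ℕ.< q
        k<q = subst (k ℕ.<_) eq (ℕP.m<n+m k (s≤s ℕ.z≤n))

    coeffSum-G : ∀ r → r ≤ p → coeffSum r G ≡ + r ·δ+const
    coeffSum-G zero    _         = 0ℤ , λ j → refl
    coeffSum-G (suc r) (s≤s r≤q) = ≡·δ+const-+ (G-coeff r r≤q) (coeffSum-G r (ℕP.m≤n⇒m≤1+n r≤q))

    prime⇒P≡p : P m p ≡ + p [mod + repunit m p ]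
    prime⇒P≡p = ≈⇒mod (begin
        prod₁ q (λ d → 1ℤ - + (m ^ d))    ≈⟨ ≈-sym (ev-coeffSum-linProd q) ⟩
        ev p (coeffSum p G)               ≈⟨ ev-≡·δ+const (coeffSum-G p ℕP.≤-refl) ⟩
        + p                               ∎)
      where open ≈-Reasoning

-- The congruence fails for composite n

repunit∣prod : ∀ m {b} r → 1 ≤ b → b ≤ r → + repunit m b ∣ prod₁ r (λ d → 1ℤ - + (m ^ d))
repunit∣prod m zero    (s≤s _) ()
repunit∣prod m {b} (suc r) 1≤b b≤1+r with ℕP.m≤n⇒m<n∨m≡n b≤1+r
... | inj₁ (s≤s b≤r) = ∣m⇒∣m*n _ (repunit∣prod m r 1≤b b≤r)
... | inj₂ refl      = ∣n⇒∣m*n (prod₁ r (λ d → 1ℤ - + (m ^ d)))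
                         (≈⇒∣ {1ℤ} {+ (m ^ b)} (≈-sym (mod⇒≈ (^≡1-mod-repunit m b))))
  where open Congruence (+ repunit m b)

congruent⇒repunit∣ : ∀ m {n a b} → n ≡ a ℕ.* b → 1 ≤ b → b ℕ.< n →
                     P m n ≡ + n [mod + repunit m n ] → repunit m b ℕ∣.∣ n
congruent⇒repunit∣ m {suc n} {a} {b} n≡a*b 1≤b (s≤s b≤n) P≡n =
  ∣⇒∣ᵤ (subst (_ ∣_) (P-[P-n]≡n (prod₁ n (λ d → 1ℤ - + (m ^ d))) (+ suc n))
    (∣m∣n⇒∣m-n (repunit∣prod m n 1≤b b≤n) (∣-trans Rb∣Rn (≈⇒∣ {P m (suc n)} {+ suc n} (mod⇒≈ P≡n)))))
  where
  open Congruence (+ repunit m (suc n))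
  Rb∣Rn : + repunit m b ∣ + repunit m (suc n)
  Rb∣Rn = ∣ᵤ⇒∣ (subst (λ x → repunit m b ℕ∣.∣ repunit m x) (sym n≡a*b) (repunit∣repunit-* m a b))
  P-[P-n]≡n : ∀ P n → P - (P - n) ≡ n
  P-[P-n]≡n = solve-∀

congruent⇒repunit≤ : ∀ m {n a b} → n ≡ a ℕ.* b → 2 ≤ a → 1 ≤ b →
                     P m n ≡ + n [mod + repunit m n ] → repunit m b ≤ n
congruent⇒repunit≤ m {n} {a} {b} n≡a*b 2≤a 1≤b P≡n =
  ℕ∣.∣⇒≤ {{ℕ.>-nonZero (ℕP.≤-<-trans ℕ.z≤n b<n)}} (congruent⇒repunit∣ m {a = a} n≡a*b 1≤b b<n P≡n)
  where
  b<n : b ℕ.< n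
  b<n = subst (b ℕ.<_) (trans (ℕP.*-comm b a) (sym n≡a*b)) (ℕP.m<m*n b a {{ℕ.>-nonZero 1≤b}} 2≤a)

composite⇒factors : ∀ {n} → Composite n → ∃ λ a → ∃ λ b → 2 ≤ a × a ≤ b × n ≡ a ℕ.* b
composite⇒factors {n} (composite {d} d<n (ℕ∣.divides c n≡c*d)) = split c n≡c*d
  where
  split : ∀ c → n ≡ c ℕ.* d → ∃ λ a → ∃ λ b → 2 ≤ a × a ≤ b × n ≡ a ℕ.* b
  split zero             n≡0   = ⊥-elim (ℕP.n≮0 (subst (d ℕ.<_) n≡0 d<n))
  split (suc zero)       n≡d+0 = ⊥-elim (ℕP.<-irrefl (sym (trans n≡d+0 (ℕP.+-identityʳ d))) d<n)
  split c@(suc (suc _))  n≡c*d with ℕP.≤-total d c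
  ... | inj₁ d≤c = d , c , ℕ.nonTrivial⇒n>1 d , d≤c , trans n≡c*d (ℕP.*-comm c d)
  ... | inj₂ c≤d = c , d , s≤s (s≤s ℕ.z≤n) , c≤d , n≡c*d

-- P 3 4 - 4 = -420 is not a multiple of repunit 3 4 = 40.
P[3,4]-incongruent : ¬ (P 3 4 ≡ + 4 [mod + repunit 3 4 ])
P[3,4]-incongruent (q , eq) = from-no (+ repunit 3 4 ∣? (P 3 4 - + 4)) (divides q eq)

-- With n = a b and 2 ≤ a ≤ b we get repunit m b ≤ n ≤ b², impossible once b ≥ 3; for b = 2 it
-- forces n = 4 and m = 3, where repunit 3 2 = 4 does divide n.
composite⇒incongruent : ∀ {m n} → 3 ≤ m → Composite n → ¬ (P m n ≡ + n [mod + repunit m n ])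
composite⇒incongruent {m} {n} 3≤m composite[n] P≡n with composite⇒factors composite[n]
... | a , b , 2≤a , a≤b , n≡a*b = too-small b 2≤a a≤b n≡a*b
  where
  too-small : ∀ {a} b → 2 ≤ a → a ≤ b → n ≡ a ℕ.* b → ⊥
  too-small zero       2≤a a≤b _ with ℕP.≤-trans 2≤a a≤b
  ... | ()
  too-small (suc zero) 2≤a a≤b _ with ℕP.≤-trans 2≤a a≤b
  ... | s≤s ()
  too-small (suc (suc zero)) 2≤a a≤2 n≡a*2 with ℕP.≤-antisym a≤2 2≤a
  ... | refl = P[3,4]-incongruent (subst₂ (λ m n → P m n ≡ + n [mod + repunit m n ]) m≡3 n≡a*2 P≡n)
    where
    repunit≤4 : repunit m 2 ≤ 4
    repunit≤4 = subst (repunit m 2 ≤_) n≡a*2 (congruent⇒repunit≤ m {a = 2} n≡a*2 2≤a (s≤s ℕ.z≤n) P≡n)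
    m≡3 : m ≡ 3
    m≡3 = ℕP.≤-antisym (ℕP.≤-pred (ℕP.≤-trans (s≤s (ℕP.m≤m*n m _)) repunit≤4)) 3≤m
  too-small {a} (suc (suc (suc c))) 2≤a a≤b n≡a*b = ℕP.<-irrefl refl (begin-strict
      n                        ≡⟨ n≡a*b ⟩
      a ℕ.* (3 ℕ.+ c)          ≤⟨ ℕP.*-monoˡ-≤ (3 ℕ.+ c) a≤b ⟩
      (3 ℕ.+ c) ℕ.* (3 ℕ.+ c)  <⟨ square<repunit 3≤m c ⟩
      repunit m (3 ℕ.+ c)      ≤⟨ congruent⇒repunit≤ m {a = a} n≡a*b 2≤a (s≤s ℕ.z≤n) P≡n ⟩
      n                        ∎)
    where open ℕP.≤-Reasoning

theorem2 : (m n : ℕ) → 2 < m → 2 < n →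
    Prime n ⇔ (P m n ≡ + n [mod + M m n ])
theorem2 (suc (suc k)) (suc (suc n)) 3≤m _ =
  subst (λ K → Prime (2 ℕ.+ n) ⇔ (P (2 ℕ.+ k) (2 ℕ.+ n) ≡ + (2 ℕ.+ n) [mod + K ]))
        (sym (M≡repunit k (2 ℕ.+ n)))
        (mk⇔ (CyclotomicCongruence.prime⇒P≡p (2 ℕ.+ k) (suc n))
             (λ P≡n → ¬composite⇒prime (λ c → composite⇒incongruent 3≤m c P≡n)))
theorem2 zero          _             ()          _
theorem2 (suc zero)    _             (s≤s ())    _
theorem2 (suc (suc k)) zero          _           ()
theorem2 (suc (suc k)) (suc zero)    _           (s≤s ())
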